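{- For every integer $r\ge0$, \[ e^z \left( \frac{z}{e^z -1}\right)^{r+1} = \sum_{m =0}^r (-1)^m \left[{r \atop r-m}\right] \Big/ \binom{r}{r-m}\, \frac{z^m}{m!} + O(z^{r+1})\qquad (z\to0). \]
   Context: $\left[{n \atop m}\right]$ denotes the (unsigned) Stirling number of the first kind, the number of permutations of an $n$-element set with exactly $m$ disjoint cycles; equivalently $x(x+1)\cdots(x+n-1)=\sum_{m=0}^n\left[{n \atop m}\right]x^m$. -}

module Defs where

open import Data.Nat as ℕ using (ℕ; zero; suc; _∸_; _!)
open import Data.Nat.Combinatorics using (_C_)
open import Data.Integer as ℤ using (ℤ)
open import Data.Rational as ℚ using (ℚ; 0ℚ; 1ℚ; _+_; _*_; -_; _÷_; _≟_)
open import Data.List using (List; []; _∷_; map; foldr; upTo; zipWith)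
open import Relation.Nullary using (yes; no)

ℕ→ℚ : ℕ → ℚ
ℕ→ℚ n = ℤ.+ n ℚ./ 1

-- Total division on ℚ (convention p / 0 = 0; only used with nonzero divisors)
_/ℚ_ : ℚ → ℚ → ℚ
p /ℚ q with q ≟ 0ℚ
... | yes _ = 0ℚ
... | no q≢0 = (p ÷ q) {{ℚ.≢-nonZero q≢0}}

sgn : ℕ → ℚ
sgn zero = 1ℚ
sgn (suc m) = - sgn m

stirling1 : ℕ → ℕ → ℕ
stirling1 zero zero = 1
stirling1 zero (suc k) = 0
stirling1 (suc n) zero = 0
stirling1 (suc n) (suc k) = n ℕ.* stirling1 n (suc k) ℕ.+ stirling1 n k

PowerSeries : Set
PowerSeries = ℕ → ℚ

sumℚ : List ℚ → ℚ
sumℚ = foldr _+_ 0ℚ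

_·_ : PowerSeries → PowerSeries → PowerSeries
(f · g) n = sumℚ (map (λ k → f k * g (n ∸ k)) (upTo (suc n)))

oneS : PowerSeries
oneS zero = 1ℚ
oneS (suc n) = 0ℚ

_^S_ : PowerSeries → ℕ → PowerSeries
f ^S zero = oneS
f ^S suc k = f · (f ^S k)

-- Multiplicative inverse of a power series a with constant term 1:
-- b_0 = 1,  b_n = - Σ_{k=1}^{n} a_k b_{n-k}.
-- invRev a n = [b_n, b_{n-1}, ..., b_0]
invRev : PowerSeries → ℕ → List ℚ
invRev a zero = 1ℚ ∷ []
invRev a (suc n) =
  (- sumℚ (zipWith _*_ (map (λ k → a (suc k)) (upTo (suc n))) bs)) ∷ bs
  where bs = invRev a n

invS₁ : PowerSeries → PowerSeries
invS₁ a n with invRev a n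
... | [] = 0ℚ
... | b ∷ _ = b

expS : PowerSeries
expS n = 1ℚ /ℚ ℕ→ℚ (n !)

-- (e^z - 1)/z = Σ z^n / (n+1)!   (constant term 1)
expm1DivZ : PowerSeries
expm1DivZ n = 1ℚ /ℚ ℕ→ℚ (suc n !)

zOverExpm1 : PowerSeries
zOverExpm1 = invS₁ expm1DivZ

lhsSeries : ℕ → PowerSeries
lhsSeries r = expS · (zOverExpm1 ^S suc r)

rhsCoeff : ℕ → ℕ → ℚ
rhsCoeff r m =
  ((sgn m * ℕ→ℚ (stirling1 r (r ∸ m))) /ℚ ℕ→ℚ (r C (r ∸ m))) /ℚ ℕ→ℚ (m !)

module Submission where

-- Let B = z/(e^z - 1), F_r = e^z B^(r+1) and let θ = z d/dz be the Euler operator.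
-- Differentiating ((e^z - 1)/z) · B = 1 gives the Riccati-type equation
-- θB = B - B² - zB, hence by the power rule θ(B^(k+1)) = (k+1)(B^(k+1) - B^(k+2) - zB^(k+1)),
-- and together with θe^z = z e^z
--     θF_r = zF_r + (r+1)(F_r - F_(r+1) - zF_r).
-- Comparing coefficients of z^m, the numbers G(r,m) = r! [z^m] F_r satisfy G(0,0) = 1,
--     G(r+1,0) = (r+1) G(r,0),   G(r+1,k+1) = (r-k) G(r,k+1) - r G(r,k),
-- and this recurrence determines its solution on m ≤ r.  By the defining recurrence of
-- the Stirling numbers, (-1)^m [r, r-m] (r-m)! is a solution too, so the two agree;
-- dividing by r! = binom(r, r-m) (r-m)! m! gives the theorem.

open import Defs
open import Data.Nat using (ℕ; _≤_)
open import Relation.Binary.PropositionalEquality using (_≡_)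

open import Data.Nat as ℕ using (zero; suc; _∸_; _!; _<_; z≤n; s≤s)
import Data.Nat.Properties as ℕP
open import Data.Nat.Tactic.RingSolver using (solve-∀)
open import Data.Nat.Combinatorics using (_C_; nCk≡n!/k![n-k]!; k![n∸k]!∣n!)
open import Data.Nat.DivMod using (m/n*n≡m)
open import Data.Integer as ℤ using ()
open import Data.Rational as ℚ using (ℚ; 0ℚ; 1ℚ; _+_; _*_; -_; _-_; _≟_)
import Data.Rational.Properties as ℚP
import Data.Rational.Unnormalised as ℚᵘ
import Data.Rational.Unnormalised.Properties as ℚᵘP
open import Data.Rational.Solver using (module +-*-Solver)
open +-*-Solver using (solve; _:=_; _:+_; _:-_; _:*_; :-_; con)
open import Data.List using (_∷_; map; upTo; applyUpTo; zipWith)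
import Data.List.Properties as ListP
open import Data.Sum using (inj₁; inj₂)
open import Data.Empty using (⊥-elim)
open import Relation.Nullary using (yes; no)
open import Relation.Binary.PropositionalEquality
  using (_≢_; _≗_; refl; sym; trans; cong; cong₂; module ≡-Reasoning)

open ≡-Reasoning

-- The image of a natural number in ℚ, by iterated addition, so that ι (suc n)
-- unfolds to 1 + ι n; it coincides with the embedding ℕ→ℚ of Defs.
ι : ℕ → ℚ
ι zero = 0ℚ
ι (suc n) = 1ℚ + ι n

ℕ→ℚ-toℚᵘ : ∀ n → ℚ.toℚᵘ (ℕ→ℚ n) ℚᵘ.≃ ℚᵘ.mkℚᵘ (ℤ.+ n) 0
ℕ→ℚ-toℚᵘ n = ℚP.toℚᵘ-fromℚᵘ (ℚᵘ.mkℚᵘ (ℤ.+ n) 0)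

ℕ→ℚ-suc : ∀ n → ℕ→ℚ (suc n) ≡ 1ℚ + ℕ→ℚ n
ℕ→ℚ-suc n = ℚP.toℚᵘ-injective (begin≃
    ℚ.toℚᵘ (ℕ→ℚ (suc n))                      ≈⟨ ℕ→ℚ-toℚᵘ (suc n) ⟩
    ℚᵘ.mkℚᵘ (ℤ.+ suc n) 0                     ≈⟨ ℚᵘ.*≡* (numerators (ℤ.+ n)) ⟩
    ℚᵘ.1ℚᵘ ℚᵘ.+ ℚᵘ.mkℚᵘ (ℤ.+ n) 0             ≈⟨ ℚᵘP.+-congʳ ℚᵘ.1ℚᵘ (ℕ→ℚ-toℚᵘ n) ⟨
    ℚ.toℚᵘ 1ℚ ℚᵘ.+ ℚ.toℚᵘ (ℕ→ℚ n)            ≈⟨ ℚP.toℚᵘ-homo-+ 1ℚ (ℕ→ℚ n) ⟨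
    ℚ.toℚᵘ (1ℚ + ℕ→ℚ n)                       ∎≃)
  where
  open ℚᵘP.≃-Reasoning using (step-≈-⟩; step-≈-⟨) renaming (begin_ to begin≃_; _∎ to _∎≃)
  open import Data.Integer.Tactic.RingSolver using () renaming (solve-∀ to ℤsolve-∀)
  numerators : ∀ (x : ℤ.ℤ) → (ℤ.1ℤ ℤ.+ x) ℤ.* (ℤ.1ℤ ℤ.* ℤ.1ℤ)
                             ≡ (ℤ.1ℤ ℤ.* ℤ.1ℤ ℤ.+ x ℤ.* ℤ.1ℤ) ℤ.* ℤ.1ℤ
  numerators = ℤsolve-∀

ℕ→ℚ≡ι : ∀ n → ℕ→ℚ n ≡ ι n
ℕ→ℚ≡ι zero = refl
ℕ→ℚ≡ι (suc n) = trans (ℕ→ℚ-suc n) (cong (1ℚ +_) (ℕ→ℚ≡ι n))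

ι-+ : ∀ a b → ι (a ℕ.+ b) ≡ ι a + ι b
ι-+ zero b = sym (ℚP.+-identityˡ (ι b))
ι-+ (suc a) b = trans (cong (1ℚ +_) (ι-+ a b)) (sym (ℚP.+-assoc 1ℚ (ι a) (ι b)))

ι-* : ∀ a b → ι (a ℕ.* b) ≡ ι a * ι b
ι-* zero b = sym (ℚP.*-zeroˡ (ι b))
ι-* (suc a) b = begin
  ι (b ℕ.+ a ℕ.* b)     ≡⟨ ι-+ b (a ℕ.* b) ⟩
  ι b + ι (a ℕ.* b)     ≡⟨ cong (ι b +_) (ι-* a b) ⟩
  ι b + ι a * ι b       ≡⟨ solve 2 (λ x y → y :+ x :* y := (con 1ℚ :+ x) :* y) refl (ι a) (ι b) ⟩
  (1ℚ + ι a) * ι b      ∎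

ι-suc-∸ : ∀ {r k} → k ≤ r → ι (suc r) - ι (suc k) ≡ ι (r ∸ k)
ι-suc-∸ {r} {k} k≤r = begin
  (1ℚ + ι r) - (1ℚ + ι k)                ≡⟨ cong (λ t → (1ℚ + ι t) - (1ℚ + ι k)) (sym (ℕP.m∸n+n≡m k≤r)) ⟩
  (1ℚ + ι (r ∸ k ℕ.+ k)) - (1ℚ + ι k)    ≡⟨ cong (λ t → (1ℚ + t) - (1ℚ + ι k)) (ι-+ (r ∸ k) k) ⟩
  (1ℚ + (ι (r ∸ k) + ι k)) - (1ℚ + ι k)  ≡⟨ solve 2 (λ d x → (con 1ℚ :+ (d :+ x)) :- (con 1ℚ :+ x) := d) refl (ι (r ∸ k)) (ι k) ⟩
  ι (r ∸ k)                              ∎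

ι-nonzero : ∀ {n} → 1 ≤ n → ι n ≢ 0ℚ
ι-nonzero {suc n} _ ι[n]≡0
  with ℚᵘP.≃-trans (ℚᵘP.≃-sym (ℕ→ℚ-toℚᵘ (suc n)))
                   (ℚP.toℚᵘ-cong (trans (ℕ→ℚ≡ι (suc n)) ι[n]≡0))
... | ℚᵘ.*≡* ()

/ℚ-cancel : ∀ x {n} → 1 ≤ n → (x /ℚ ℕ→ℚ n) * ι n ≡ x
/ℚ-cancel x {n} 1≤n with ℕ→ℚ n ≟ 0ℚ
... | yes ℕ→ℚ[n]≡0 = ⊥-elim (ι-nonzero 1≤n (trans (sym (ℕ→ℚ≡ι n)) ℕ→ℚ[n]≡0))
... | no ℕ→ℚ[n]≢0 = begin
  x * y⁻¹ * ι n     ≡⟨ cong (x * y⁻¹ *_) (sym (ℕ→ℚ≡ι n)) ⟩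
  x * y⁻¹ * y       ≡⟨ ℚP.*-assoc x y⁻¹ y ⟩
  x * (y⁻¹ * y)     ≡⟨ cong (x *_) (ℚP.*-inverseˡ y) ⟩
  x * 1ℚ            ≡⟨ ℚP.*-identityʳ x ⟩
  x                 ∎
  where
  y = ℕ→ℚ n
  instance _ = ℚ.≢-nonZero ℕ→ℚ[n]≢0
  y⁻¹ = ℚ.1/ y

*-cancelʳ : ∀ {x y a} → a ≢ 0ℚ → x * a ≡ y * a → x ≡ y
*-cancelʳ {x} {y} {a} a≢0 xa≡ya = begin
  x                   ≡⟨ regroup x ⟩
  x * a * ℚ.1/ a      ≡⟨ cong (_* ℚ.1/ a) xa≡ya ⟩
  y * a * ℚ.1/ a      ≡⟨ sym (regroup y) ⟩
  y                   ∎
  where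
  instance _ = ℚ.≢-nonZero a≢0
  regroup : ∀ z → z ≡ z * a * ℚ.1/ a
  regroup z = sym (trans (ℚP.*-assoc z a _)
                    (trans (cong (z *_) (ℚP.*-inverseʳ a)) (ℚP.*-identityʳ z)))

infixl 7 _⋆_ _⊙_
infixl 6 _⊕_ _⊖_

_⊕_ _⊖_ : PowerSeries → PowerSeries → PowerSeries
(f ⊕ g) n = f n + g n
(f ⊖ g) n = f n - g n

_⊙_ : ℚ → PowerSeries → PowerSeries
(c ⊙ f) n = c * f n

tail : PowerSeries → PowerSeries
tail f n = f (suc n)

shift : PowerSeries → PowerSeries
shift f zero = 0ℚ
shift f (suc n) = f n

θ : PowerSeries → PowerSeries
θ f n = ι n * f n

-- The Cauchy product, by recursion on the degree: f·g = f₀g + z((f - f₀)/z · g).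
_⋆_ : PowerSeries → PowerSeries → PowerSeries
(f ⋆ g) zero = f 0 * g 0
(f ⋆ g) (suc n) = f 0 * g (suc n) + (tail f ⋆ g) n

sum≡⋆ : ∀ f g n → sumℚ (applyUpTo (λ k → f k * g (n ∸ k)) (suc n)) ≡ (f ⋆ g) n
sum≡⋆ f g zero = ℚP.+-identityʳ (f 0 * g 0)
sum≡⋆ f g (suc n) = cong (f 0 * g (suc n) +_) (sum≡⋆ (tail f) g n)

·≗⋆ : ∀ f g → f · g ≗ f ⋆ g
·≗⋆ f g n = trans (cong sumℚ (ListP.map-upTo (λ k → f k * g (n ∸ k)) (suc n))) (sum≡⋆ f g n)

^S-suc : ∀ f k → f ^S suc k ≗ f ⋆ f ^S k
^S-suc f k = ·≗⋆ f (f ^S k)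

shift-cong : ∀ {f g} → f ≗ g → shift f ≗ shift g
shift-cong f≗g zero = refl
shift-cong f≗g (suc n) = f≗g n

⋆-congˡ : ∀ {f f'} g → f ≗ f' → f ⋆ g ≗ f' ⋆ g
⋆-congˡ g f≗f' zero = cong (_* g 0) (f≗f' 0)
⋆-congˡ g f≗f' (suc n) =
  cong₂ _+_ (cong (_* g (suc n)) (f≗f' 0)) (⋆-congˡ g (λ k → f≗f' (suc k)) n)

⋆-congʳ : ∀ f {g g'} → g ≗ g' → f ⋆ g ≗ f ⋆ g'
⋆-congʳ f g≗g' zero = cong (f 0 *_) (g≗g' 0)
⋆-congʳ f g≗g' (suc n) = cong₂ _+_ (cong (f 0 *_) (g≗g' (suc n))) (⋆-congʳ (tail f) g≗g' n)

-- Linearity in the left factor, along which the product recurses; the right-hand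
-- versions follow below from commutativity.
⋆-distribʳ-⊕ : ∀ f g h → (f ⊕ g) ⋆ h ≗ f ⋆ h ⊕ g ⋆ h
⋆-distribʳ-⊕ f g h zero = ℚP.*-distribʳ-+ (h 0) (f 0) (g 0)
⋆-distribʳ-⊕ f g h (suc n) = begin
  (f 0 + g 0) * h (suc n) + ((tail f ⊕ tail g) ⋆ h) n
    ≡⟨ cong ((f 0 + g 0) * h (suc n) +_) (⋆-distribʳ-⊕ (tail f) (tail g) h n) ⟩
  (f 0 + g 0) * h (suc n) + ((tail f ⋆ h) n + (tail g ⋆ h) n)
    ≡⟨ solve 5 (λ a b c x y → (a :+ b) :* c :+ (x :+ y) := (a :* c :+ x) :+ (b :* c :+ y))
             refl (f 0) (g 0) (h (suc n)) ((tail f ⋆ h) n) ((tail g ⋆ h) n) ⟩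
  (f 0 * h (suc n) + (tail f ⋆ h) n) + (g 0 * h (suc n) + (tail g ⋆ h) n) ∎

⋆-distribʳ-⊖ : ∀ f g h → (f ⊖ g) ⋆ h ≗ f ⋆ h ⊖ g ⋆ h
⋆-distribʳ-⊖ f g h zero =
  solve 3 (λ a b c → (a :- b) :* c := a :* c :- b :* c) refl (f 0) (g 0) (h 0)
⋆-distribʳ-⊖ f g h (suc n) = begin
  (f 0 - g 0) * h (suc n) + ((tail f ⊖ tail g) ⋆ h) n
    ≡⟨ cong ((f 0 - g 0) * h (suc n) +_) (⋆-distribʳ-⊖ (tail f) (tail g) h n) ⟩
  (f 0 - g 0) * h (suc n) + ((tail f ⋆ h) n - (tail g ⋆ h) n)
    ≡⟨ solve 5 (λ a b c x y → (a :- b) :* c :+ (x :- y) := (a :* c :+ x) :- (b :* c :+ y))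
             refl (f 0) (g 0) (h (suc n)) ((tail f ⋆ h) n) ((tail g ⋆ h) n) ⟩
  (f 0 * h (suc n) + (tail f ⋆ h) n) - (g 0 * h (suc n) + (tail g ⋆ h) n) ∎

⋆-scaleˡ : ∀ c f g → (c ⊙ f) ⋆ g ≗ c ⊙ (f ⋆ g)
⋆-scaleˡ c f g zero = ℚP.*-assoc c (f 0) (g 0)
⋆-scaleˡ c f g (suc n) = begin
  c * f 0 * g (suc n) + ((c ⊙ tail f) ⋆ g) n   ≡⟨ cong (c * f 0 * g (suc n) +_) (⋆-scaleˡ c (tail f) g n) ⟩
  c * f 0 * g (suc n) + c * (tail f ⋆ g) n     ≡⟨ solve 4 (λ c a b x → c :* a :* b :+ c :* x := c :* (a :* b :+ x))
                                                        refl c (f 0) (g (suc n)) ((tail f ⋆ g) n) ⟩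
  c * (f 0 * g (suc n) + (tail f ⋆ g) n)       ∎

⋆-zeroˡ : ∀ g → (λ _ → 0ℚ) ⋆ g ≗ (λ _ → 0ℚ)
⋆-zeroˡ g zero = ℚP.*-zeroˡ (g 0)
⋆-zeroˡ g (suc n) = trans (cong₂ _+_ (ℚP.*-zeroˡ (g (suc n))) (⋆-zeroˡ g n)) (ℚP.+-identityˡ 0ℚ)

⋆-identityˡ : ∀ g → oneS ⋆ g ≗ g
⋆-identityˡ g zero = ℚP.*-identityˡ (g 0)
⋆-identityˡ g (suc n) =
  trans (cong₂ _+_ (ℚP.*-identityˡ (g (suc n))) (⋆-zeroˡ g n)) (ℚP.+-identityʳ (g (suc n)))

⋆-shiftˡ : ∀ f g → shift f ⋆ g ≗ shift (f ⋆ g)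
⋆-shiftˡ f g zero = ℚP.*-zeroˡ (g 0)
⋆-shiftˡ f g (suc n) = trans (cong (_+ (f ⋆ g) n) (ℚP.*-zeroˡ (g (suc n)))) (ℚP.+-identityˡ _)

⋆-sucʳ : ∀ f g n → (f ⋆ g) (suc n) ≡ (f ⋆ tail g) n + f (suc n) * g 0
⋆-sucʳ f g zero = refl
⋆-sucʳ f g (suc n) = begin
  f 0 * g (suc (suc n)) + (tail f ⋆ g) (suc n)
    ≡⟨ cong (f 0 * g (suc (suc n)) +_) (⋆-sucʳ (tail f) g n) ⟩
  f 0 * g (suc (suc n)) + ((tail f ⋆ tail g) n + f (suc (suc n)) * g 0)
    ≡⟨ sym (ℚP.+-assoc (f 0 * g (suc (suc n))) _ _) ⟩
  f 0 * g (suc (suc n)) + (tail f ⋆ tail g) n + f (suc (suc n)) * g 0 ∎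

⋆-comm : ∀ f g → f ⋆ g ≗ g ⋆ f
⋆-comm f g zero = ℚP.*-comm (f 0) (g 0)
⋆-comm f g (suc n) = begin
  f 0 * g (suc n) + (tail f ⋆ g) n   ≡⟨ cong (f 0 * g (suc n) +_) (⋆-comm (tail f) g n) ⟩
  f 0 * g (suc n) + (g ⋆ tail f) n   ≡⟨ solve 3 (λ a b x → a :* b :+ x := x :+ b :* a) refl (f 0) (g (suc n)) ((g ⋆ tail f) n) ⟩
  (g ⋆ tail f) n + g (suc n) * f 0   ≡⟨ sym (⋆-sucʳ g f n) ⟩
  (g ⋆ f) (suc n)                    ∎

⋆-assoc : ∀ f g h → (f ⋆ g) ⋆ h ≗ f ⋆ (g ⋆ h)
⋆-assoc f g h zero = ℚP.*-assoc (f 0) (g 0) (h 0)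
⋆-assoc f g h (suc n) = begin
  f 0 * g 0 * h (suc n) + ((f 0 ⊙ tail g ⊕ tail f ⋆ g) ⋆ h) n
    ≡⟨ cong (f 0 * g 0 * h (suc n) +_) (⋆-distribʳ-⊕ (f 0 ⊙ tail g) (tail f ⋆ g) h n) ⟩
  f 0 * g 0 * h (suc n) + (((f 0 ⊙ tail g) ⋆ h) n + ((tail f ⋆ g) ⋆ h) n)
    ≡⟨ cong₂ (λ x y → f 0 * g 0 * h (suc n) + (x + y)) (⋆-scaleˡ (f 0) (tail g) h n) (⋆-assoc (tail f) g h n) ⟩
  f 0 * g 0 * h (suc n) + (f 0 * (tail g ⋆ h) n + (tail f ⋆ (g ⋆ h)) n)
    ≡⟨ solve 5 (λ a b c x y → a :* b :* c :+ (a :* x :+ y) := a :* (b :* c :+ x) :+ y)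
             refl (f 0) (g 0) (h (suc n)) ((tail g ⋆ h) n) ((tail f ⋆ (g ⋆ h)) n) ⟩
  f 0 * (g 0 * h (suc n) + (tail g ⋆ h) n) + (tail f ⋆ (g ⋆ h)) n ∎

⋆-identityʳ : ∀ f → f ⋆ oneS ≗ f
⋆-identityʳ f n = trans (⋆-comm f oneS n) (⋆-identityˡ f n)

⋆-distribˡ-⊖ : ∀ h f g → h ⋆ (f ⊖ g) ≗ h ⋆ f ⊖ h ⋆ g
⋆-distribˡ-⊖ h f g n = begin
  (h ⋆ (f ⊖ g)) n          ≡⟨ ⋆-comm h (f ⊖ g) n ⟩
  ((f ⊖ g) ⋆ h) n          ≡⟨ ⋆-distribʳ-⊖ f g h n ⟩
  (f ⋆ h) n - (g ⋆ h) n    ≡⟨ cong₂ _-_ (⋆-comm f h n) (⋆-comm g h n) ⟩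
  (h ⋆ f) n - (h ⋆ g) n    ∎

⋆-scaleʳ : ∀ c f g → f ⋆ (c ⊙ g) ≗ c ⊙ (f ⋆ g)
⋆-scaleʳ c f g n = trans (⋆-comm f (c ⊙ g) n)
  (trans (⋆-scaleˡ c g f n) (cong (c *_) (⋆-comm g f n)))

⋆-shiftʳ : ∀ f g → f ⋆ shift g ≗ shift (f ⋆ g)
⋆-shiftʳ f g n = trans (⋆-comm f (shift g) n)
  (trans (⋆-shiftˡ g f n) (shift-cong (⋆-comm g f) n))

⋆-power-comm : ∀ b k → b ^S k ⋆ b ≗ b ^S suc k
⋆-power-comm b k n = trans (⋆-comm (b ^S k) b n) (sym (^S-suc b k n))

θ-leibniz : ∀ f g → θ (f ⋆ g) ≗ θ f ⋆ g ⊕ f ⋆ θ g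
θ-leibniz f g zero =
  solve 2 (λ a b → con 0ℚ :* (a :* b) := con 0ℚ :* a :* b :+ a :* (con 0ℚ :* b)) refl (f 0) (g 0)
θ-leibniz f g (suc n) = begin
  (1ℚ + i) * (a * b + c)
    ≡⟨ solve 4 (λ i a b c → (con 1ℚ :+ i) :* (a :* b :+ c)
                          := (con 0ℚ :* a :* b :+ c) :+ a :* ((con 1ℚ :+ i) :* b) :+ i :* c)
             refl i a b c ⟩
  (0ℚ * a * b + c) + a * ((1ℚ + i) * b) + ι n * (tail f ⋆ g) n
    ≡⟨ cong ((0ℚ * a * b + c) + a * ((1ℚ + i) * b) +_) (θ-leibniz (tail f) g n) ⟩
  (0ℚ * a * b + c) + a * ((1ℚ + i) * b) + ((θ (tail f) ⋆ g) n + (tail f ⋆ θ g) n)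
    ≡⟨ solve 5 (λ z c a' x y → (z :+ c) :+ a' :+ (x :+ y) := (z :+ (x :+ c)) :+ (a' :+ y))
             refl (0ℚ * a * b) c (a * ((1ℚ + i) * b)) ((θ (tail f) ⋆ g) n) ((tail f ⋆ θ g) n) ⟩
  (0ℚ * a * b + ((θ (tail f) ⋆ g) n + c)) + (a * ((1ℚ + i) * b) + (tail f ⋆ θ g) n)
    ≡⟨ cong (λ t → (0ℚ * a * b + t) + (a * ((1ℚ + i) * b) + (tail f ⋆ θ g) n)) (sym tail-θ) ⟩
  (θ f ⋆ g) (suc n) + (f ⋆ θ g) (suc n) ∎
  where
  i = ι n
  a = f 0
  b = g (suc n)
  c = (tail f ⋆ g) n
  -- (θf - (θf)₀)/z = θ((f - f₀)/z) + (f - f₀)/z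
  tail-θ : (tail (θ f) ⋆ g) n ≡ (θ (tail f) ⋆ g) n + c
  tail-θ = trans (⋆-congˡ g (λ k → solve 2 (λ j x → (con 1ℚ :+ j) :* x := j :* x :+ x) refl (ι k) (f (suc k))) n)
                 (⋆-distribʳ-⊕ (θ (tail f)) (tail f) g n)

θ-cong : ∀ {f g} → f ≗ g → θ f ≗ θ g
θ-cong f≗g n = cong (ι n *_) (f≗g n)

θ-oneS : ∀ n → θ oneS n ≡ 0ℚ
θ-oneS zero = ℚP.*-zeroˡ 1ℚ
θ-oneS (suc n) = ℚP.*-zeroʳ (ι (suc n))

θ-power : ∀ b k → θ (b ^S suc k) ≗ ι (suc k) ⊙ (b ^S k ⋆ θ b)
θ-power b zero n = begin
  ι n * (b ^S 1) n             ≡⟨ cong (ι n *_) (trans (^S-suc b 0 n) (⋆-identityʳ b n)) ⟩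
  θ b n                        ≡⟨ solve 1 (λ x → x := (con 1ℚ :+ con 0ℚ) :* x) refl (θ b n) ⟩
  ι 1 * θ b n                  ≡⟨ cong (ι 1 *_) (sym (⋆-identityˡ (θ b) n)) ⟩
  ι 1 * (oneS ⋆ θ b) n         ∎
θ-power b (suc k) n = begin
  θ (b ^S suc (suc k)) n
    ≡⟨ θ-cong (^S-suc b (suc k)) n ⟩
  θ (b ⋆ P) n
    ≡⟨ θ-leibniz b P n ⟩
  (θ b ⋆ P) n + (b ⋆ θ P) n
    ≡⟨ cong₂ _+_ (⋆-comm (θ b) P n) (⋆-congʳ b (θ-power b k) n) ⟩
  (P ⋆ θ b) n + (b ⋆ (ι (suc k) ⊙ (b ^S k ⋆ θ b))) n
    ≡⟨ cong ((P ⋆ θ b) n +_) (⋆-scaleʳ (ι (suc k)) b (b ^S k ⋆ θ b) n) ⟩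
  (P ⋆ θ b) n + ι (suc k) * (b ⋆ (b ^S k ⋆ θ b)) n
    ≡⟨ cong (λ t → (P ⋆ θ b) n + ι (suc k) * t)
            (trans (sym (⋆-assoc b (b ^S k) (θ b) n)) (⋆-congˡ (θ b) (λ j → sym (^S-suc b k j)) n)) ⟩
  (P ⋆ θ b) n + ι (suc k) * (P ⋆ θ b) n
    ≡⟨ solve 2 (λ x i → x :+ i :* x := (con 1ℚ :+ i) :* x) refl ((P ⋆ θ b) n) (ι (suc k)) ⟩
  ι (suc (suc k)) * (P ⋆ θ b) n ∎
  where P = b ^S suc k

expS-factorial : ∀ n → expS n * ι (n !) ≡ 1ℚ
expS-factorial n = /ℚ-cancel 1ℚ (ℕP.1≤n! n)

expS-step : ∀ n → ι (suc n) * expS (suc n) ≡ expS n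
expS-step n = *-cancelʳ (ι-nonzero (ℕP.1≤n! n)) (begin
  ι (suc n) * expS (suc n) * ι (n !)      ≡⟨ solve 3 (λ a x f → a :* x :* f := x :* (a :* f)) refl (ι (suc n)) (expS (suc n)) (ι (n !)) ⟩
  expS (suc n) * (ι (suc n) * ι (n !))    ≡⟨ cong (expS (suc n) *_) (sym (ι-* (suc n) (n !))) ⟩
  expS (suc n) * ι (suc n !)              ≡⟨ expS-factorial (suc n) ⟩
  1ℚ                                      ≡⟨ sym (expS-factorial n) ⟩
  expS n * ι (n !)                        ∎)

θ-expS : θ expS ≗ shift expS
θ-expS zero = ℚP.*-zeroˡ (expS 0)
θ-expS (suc n) = expS-step n

-- (e^z - 1)/z is the tail of e^z, so θ((e^z - 1)/z) = e^z - (e^z - 1)/z.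
θ-expm1DivZ : θ expm1DivZ ≗ expS ⊖ expm1DivZ
θ-expm1DivZ n = begin
  ι n * expm1DivZ n                          ≡⟨ solve 2 (λ i x → i :* x := (con 1ℚ :+ i) :* x :- x) refl (ι n) (expm1DivZ n) ⟩
  (1ℚ + ι n) * expm1DivZ n - expm1DivZ n     ≡⟨ cong (_- expm1DivZ n) (expS-step n) ⟩
  expS n - expm1DivZ n                       ∎

invS₁-suc : ∀ a n → invS₁ a (suc n) ≡ - (tail a ⋆ invS₁ a) n
invS₁-suc a n = cong -_ (begin
  sumℚ (zipWith _*_ (map (tail a) (upTo (suc n))) (invRev a n))
    ≡⟨ cong₂ (λ xs ys → sumℚ (zipWith _*_ xs ys)) (ListP.map-upTo (tail a) (suc n)) (invRev-reversed n) ⟩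
  sumℚ (zipWith _*_ (applyUpTo (tail a) (suc n)) (applyUpTo (λ k → invS₁ a (n ∸ k)) (suc n)))
    ≡⟨ cong sumℚ (zipWith-applyUpTo (tail a) (λ k → invS₁ a (n ∸ k)) (suc n)) ⟩
  sumℚ (applyUpTo (λ k → tail a k * invS₁ a (n ∸ k)) (suc n))
    ≡⟨ sum≡⋆ (tail a) (invS₁ a) n ⟩
  (tail a ⋆ invS₁ a) n ∎)
  where
  invRev-reversed : ∀ n → invRev a n ≡ applyUpTo (λ k → invS₁ a (n ∸ k)) (suc n)
  invRev-reversed zero = refl
  invRev-reversed (suc n) = cong (invS₁ a (suc n) ∷_) (invRev-reversed n)
  zipWith-applyUpTo : ∀ (g h : ℕ → ℚ) m →
    zipWith _*_ (applyUpTo g m) (applyUpTo h m) ≡ applyUpTo (λ k → g k * h k) m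
  zipWith-applyUpTo g h zero = refl
  zipWith-applyUpTo g h (suc m) = cong (g 0 * h 0 ∷_) (zipWith-applyUpTo (tail g) (tail h) m)

invS₁-inverse : ∀ a → a 0 ≡ 1ℚ → a ⋆ invS₁ a ≗ oneS
invS₁-inverse a a₀≡1 zero = trans (ℚP.*-identityʳ (a 0)) a₀≡1
invS₁-inverse a a₀≡1 (suc n) = begin
  a 0 * invS₁ a (suc n) + c          ≡⟨ cong₂ (λ x y → x * y + c) a₀≡1 (invS₁-suc a n) ⟩
  1ℚ * - c + c                       ≡⟨ solve 1 (λ x → con 1ℚ :* (:- x) :+ x := con 0ℚ) refl c ⟩
  0ℚ                                 ∎
  where c = (tail a ⋆ invS₁ a) n

B : PowerSeries
B = zOverExpm1

expm1DivZ⋆B : expm1DivZ ⋆ B ≗ oneS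
expm1DivZ⋆B = invS₁-inverse expm1DivZ refl

-- e^z B = B + z, since e^z = 1 + z (e^z - 1)/z.
expS⋆B : expS ⋆ B ≗ B ⊕ shift oneS
expS⋆B zero = refl
expS⋆B (suc n) = cong₂ _+_ (ℚP.*-identityˡ (B (suc n))) (expm1DivZ⋆B n)

-- Differentiating ((e^z - 1)/z) B = 1:  ((e^z - 1)/z) θB = 1 - B - z.
expm1DivZ⋆θB : expm1DivZ ⋆ θ B ≗ oneS ⊖ B ⊖ shift oneS
expm1DivZ⋆θB n = begin
  X                        ≡⟨ solve 2 (λ a x → x := (a :+ x) :- a) refl A X ⟩
  (A + X) - A              ≡⟨ cong (_- A) (sym (θ-leibniz expm1DivZ B n)) ⟩
  θ (expm1DivZ ⋆ B) n - A  ≡⟨ cong₂ _-_ (trans (θ-cong expm1DivZ⋆B n) (θ-oneS n)) θE⋆B ⟩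
  0ℚ - (B n + shift oneS n - oneS n)
    ≡⟨ solve 3 (λ b s o → con 0ℚ :- (b :+ s :- o) := o :- b :- s) refl (B n) (shift oneS n) (oneS n) ⟩
  oneS n - B n - shift oneS n ∎
  where
  X = (expm1DivZ ⋆ θ B) n
  A = (θ expm1DivZ ⋆ B) n
  θE⋆B : A ≡ B n + shift oneS n - oneS n
  θE⋆B = trans (⋆-congˡ B θ-expm1DivZ n)
           (trans (⋆-distribʳ-⊖ expS expm1DivZ B n) (cong₂ _-_ (expS⋆B n) (expm1DivZ⋆B n)))

θB : θ B ≗ B ⊖ B ⋆ B ⊖ shift B
θB n = begin
  θ B n                                ≡⟨ sym (⋆-identityˡ (θ B) n) ⟩
  (oneS ⋆ θ B) n                       ≡⟨ ⋆-congˡ (θ B) (λ k → sym (trans (⋆-comm B expm1DivZ k) (expm1DivZ⋆B k))) n ⟩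
  ((B ⋆ expm1DivZ) ⋆ θ B) n            ≡⟨ ⋆-assoc B expm1DivZ (θ B) n ⟩
  (B ⋆ (expm1DivZ ⋆ θ B)) n            ≡⟨ ⋆-congʳ B expm1DivZ⋆θB n ⟩
  (B ⋆ (oneS ⊖ B ⊖ shift oneS)) n      ≡⟨ ⋆-distribˡ-⊖ B (oneS ⊖ B) (shift oneS) n ⟩
  (B ⋆ (oneS ⊖ B)) n - (B ⋆ shift oneS) n
    ≡⟨ cong₂ _-_ (⋆-distribˡ-⊖ B oneS B n) (⋆-shiftʳ B oneS n) ⟩
  (B ⋆ oneS) n - (B ⋆ B) n - shift (B ⋆ oneS) n
    ≡⟨ cong₂ (λ x y → x - (B ⋆ B) n - y) (⋆-identityʳ B n) (shift-cong (⋆-identityʳ B) n) ⟩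
  B n - (B ⋆ B) n - shift B n          ∎

θ-Bpower : ∀ k → θ (B ^S suc k) ≗ ι (suc k) ⊙ (B ^S suc k ⊖ B ^S suc (suc k) ⊖ shift (B ^S suc k))
θ-Bpower k n = trans (θ-power B k n) (cong (ι (suc k) *_) (begin
  (P ⋆ θ B) n                                      ≡⟨ ⋆-congʳ P θB n ⟩
  (P ⋆ (B ⊖ B ⋆ B ⊖ shift B)) n                    ≡⟨ ⋆-distribˡ-⊖ P (B ⊖ B ⋆ B) (shift B) n ⟩
  (P ⋆ (B ⊖ B ⋆ B)) n - (P ⋆ shift B) n            ≡⟨ cong₂ _-_ (⋆-distribˡ-⊖ P B (B ⋆ B) n) (⋆-shiftʳ P B n) ⟩
  (P ⋆ B) n - (P ⋆ (B ⋆ B)) n - shift (P ⋆ B) n    ≡⟨ cong₂ (λ x y → x - y - shift (P ⋆ B) n) (⋆-power-comm B k n) P⋆B² ⟩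
  (B ^S suc k) n - (B ^S suc (suc k)) n - shift (P ⋆ B) n
    ≡⟨ cong (λ t → (B ^S suc k) n - (B ^S suc (suc k)) n - t) (shift-cong (⋆-power-comm B k) n) ⟩
  (B ^S suc k) n - (B ^S suc (suc k)) n - shift (B ^S suc k) n ∎))
  where
  P = B ^S k
  P⋆B² : (P ⋆ (B ⋆ B)) n ≡ (B ^S suc (suc k)) n
  P⋆B² = trans (sym (⋆-assoc P B B n))
           (trans (⋆-congˡ B (⋆-power-comm B k) n) (⋆-power-comm B (suc k) n))

F : ℕ → PowerSeries
F r = expS ⋆ B ^S suc r

lhsSeries≗F : ∀ r → lhsSeries r ≗ F r
lhsSeries≗F r = ·≗⋆ expS (B ^S suc r)

θF : ∀ r → θ (F r) ≗ shift (F r) ⊕ ι (suc r) ⊙ (F r ⊖ F (suc r) ⊖ shift (F r))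
θF r n = begin
  θ (expS ⋆ P) n                           ≡⟨ θ-leibniz expS P n ⟩
  (θ expS ⋆ P) n + (expS ⋆ θ P) n          ≡⟨ cong₂ _+_ (trans (⋆-congˡ P θ-expS n) (⋆-shiftˡ expS P n))
                                                        (⋆-congʳ expS (θ-Bpower r) n) ⟩
  shift (F r) n + (expS ⋆ (ι (suc r) ⊙ Q)) n  ≡⟨ cong (shift (F r) n +_) (⋆-scaleʳ (ι (suc r)) expS Q n) ⟩
  shift (F r) n + ι (suc r) * (expS ⋆ Q) n    ≡⟨ cong (λ t → shift (F r) n + ι (suc r) * t) expS⋆Q ⟩
  shift (F r) n + ι (suc r) * (F r n - F (suc r) n - shift (F r) n) ∎
  where
  P = B ^S suc r
  Q = P ⊖ B ^S suc (suc r) ⊖ shift P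
  expS⋆Q : (expS ⋆ Q) n ≡ F r n - F (suc r) n - shift (F r) n
  expS⋆Q = trans (⋆-distribˡ-⊖ expS (P ⊖ B ^S suc (suc r)) (shift P) n)
             (cong₂ _-_ (⋆-distribˡ-⊖ expS P (B ^S suc (suc r)) n) (⋆-shiftʳ expS P n))

-- Solving the coefficient of z^m in θF for the coefficient of F_(r+1):
-- (r+1) [z^m] F_(r+1) = (r+1-m) [z^m] F_r - r [z^(m-1)] F_r.
F-recurrence : ∀ r m → ι (suc r) * F (suc r) m ≡ (ι (suc r) - ι m) * F r m - ι r * shift (F r) m
F-recurrence r m = isolate (ι m) (F r m) (F (suc r) m) (shift (F r) m) (ι r) (θF r m)
  where
  isolate : ∀ m f f' s i → m * f ≡ s + (1ℚ + i) * (f - f' - s) →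
            (1ℚ + i) * f' ≡ ((1ℚ + i) - m) * f - i * s
  isolate m f f' s i ode = begin
    (1ℚ + i) * f'
      ≡⟨ solve 5 (λ m f f' s i → (con 1ℚ :+ i) :* f'
                               := ((con 1ℚ :+ i) :- m) :* f :- i :* s
                                  :+ (m :* f :- (s :+ (con 1ℚ :+ i) :* (f :- f' :- s))))
               refl m f f' s i ⟩
    ((1ℚ + i) - m) * f - i * s + (m * f - R)   ≡⟨ cong (λ t → ((1ℚ + i) - m) * f - i * s + (t - R)) ode ⟩
    ((1ℚ + i) - m) * f - i * s + (R - R)       ≡⟨ solve 2 (λ x y → x :+ (y :- y) := x) refl (((1ℚ + i) - m) * f - i * s) R ⟩
    ((1ℚ + i) - m) * f - i * s                 ∎
    where R = s + (1ℚ + i) * (f - f' - s)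

-- The recurrence satisfied both by r! [z^m] F_r and by (-1)^m [r, r-m] (r-m)!.
record StirlingRecurrence (X : ℕ → ℕ → ℚ) : Set where
  field
    initial : X 0 0 ≡ 1ℚ
    step₀   : ∀ r → X (suc r) 0 ≡ ι (suc r) * X r 0
    step    : ∀ r k → k ≤ r → X (suc r) (suc k) ≡ ι (r ∸ k) * X r (suc k) - ι r * X r k

-- On the triangle m ≤ r a solution is unique: the only value outside the triangle that
-- the recurrence refers to, X r (r+1), is multiplied by r - r = 0.
recurrence-unique : ∀ {X Y} → StirlingRecurrence X → StirlingRecurrence Y →
                    ∀ r m → m ≤ r → X r m ≡ Y r m
recurrence-unique {X} {Y} recX recY = unique
  where
  module RX = StirlingRecurrence recX
  module RY = StirlingRecurrence recY
  unique : ∀ r m → m ≤ r → X r m ≡ Y r m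
  unique zero zero z≤n = trans RX.initial (sym RY.initial)
  unique (suc r) zero _ = begin
    X (suc r) 0          ≡⟨ RX.step₀ r ⟩
    ι (suc r) * X r 0    ≡⟨ cong (ι (suc r) *_) (unique r 0 z≤n) ⟩
    ι (suc r) * Y r 0    ≡⟨ sym (RY.step₀ r) ⟩
    Y (suc r) 0          ∎
  unique (suc r) (suc k) (s≤s k≤r) = begin
    X (suc r) (suc k)                          ≡⟨ RX.step r k k≤r ⟩
    ι (r ∸ k) * X r (suc k) - ι r * X r k      ≡⟨ cong₂ (λ x y → x - ι r * y) leading (unique r k k≤r) ⟩
    ι (r ∸ k) * Y r (suc k) - ι r * Y r k      ≡⟨ sym (RY.step r k k≤r) ⟩
    Y (suc r) (suc k)                          ∎
    where
    leading : ι (r ∸ k) * X r (suc k) ≡ ι (r ∸ k) * Y r (suc k)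
    leading with ℕP.m≤n⇒m<n∨m≡n k≤r
    ... | inj₁ k<r = cong (ι (r ∸ k) *_) (unique r (suc k) k<r)
    ... | inj₂ refl rewrite ℕP.n∸n≡0 r = trans (ℚP.*-zeroˡ (X r (suc r))) (sym (ℚP.*-zeroˡ (Y r (suc r))))

G : ℕ → ℕ → ℚ
G r m = ι (r !) * F r m

-- Multiplying F-recurrence by r! shows that G solves the recurrence.
G-recurrence : StirlingRecurrence G
G-recurrence = record
  { initial = refl
  ; step₀   = λ r → trans (G-step r 0)
      (solve 4 (λ a g i f → (a :- con 0ℚ) :* g :- i :* (f :* con 0ℚ) := a :* g)
             refl (ι (suc r)) (G r 0) (ι r) (ι (r !)))
  ; step    = λ r k k≤r → trans (G-step r (suc k))
      (cong (λ c → c * G r (suc k) - ι r * G r k) (ι-suc-∸ k≤r))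
  }
  where
  G-step : ∀ r m → G (suc r) m ≡ (ι (suc r) - ι m) * G r m - ι r * (ι (r !) * shift (F r) m)
  G-step r m = begin
    ι (suc r ℕ.* r !) * F (suc r) m         ≡⟨ cong (_* F (suc r) m) (ι-* (suc r) (r !)) ⟩
    ι (suc r) * ι (r !) * F (suc r) m       ≡⟨ solve 3 (λ a f x → a :* f :* x := f :* (a :* x)) refl (ι (suc r)) (ι (r !)) (F (suc r) m) ⟩
    ι (r !) * (ι (suc r) * F (suc r) m)     ≡⟨ cong (ι (r !) *_) (F-recurrence r m) ⟩
    ι (r !) * ((ι (suc r) - ι m) * F r m - ι r * shift (F r) m)
      ≡⟨ solve 5 (λ f c x i s → f :* (c :* x :- i :* s) := c :* (f :* x) :- i :* (f :* s))
               refl (ι (r !)) (ι (suc r) - ι m) (F r m) (ι r) (shift (F r) m) ⟩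
    (ι (suc r) - ι m) * G r m - ι r * (ι (r !) * shift (F r) m) ∎

stirling1-vanishes : ∀ n k → n < k → stirling1 n k ≡ 0
stirling1-vanishes zero (suc k) _ = refl
stirling1-vanishes (suc n) (suc k) (s≤s n<k) = trans
  (cong₂ (λ a b → n ℕ.* a ℕ.+ b) (stirling1-vanishes n (suc k) (ℕP.m<n⇒m<1+n n<k)) (stirling1-vanishes n k n<k))
  (cong (ℕ._+ 0) (ℕP.*-zeroʳ n))

weighted : ℕ → ℕ → ℕ
weighted r m = stirling1 r (r ∸ m) ℕ.* (r ∸ m) !

weighted-step₀ : ∀ r → weighted (suc r) 0 ≡ suc r ℕ.* weighted r 0
weighted-step₀ r = begin
  (r ℕ.* stirling1 r (suc r) ℕ.+ stirling1 r r) ℕ.* (suc r ℕ.* r !)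
    ≡⟨ cong (λ s → (r ℕ.* s ℕ.+ stirling1 r r) ℕ.* (suc r ℕ.* r !)) (stirling1-vanishes r (suc r) (ℕP.n<1+n r)) ⟩
  (r ℕ.* 0 ℕ.+ stirling1 r r) ℕ.* (suc r ℕ.* r !)
    ≡⟨ identity r (stirling1 r r) (r !) ⟩
  suc r ℕ.* (stirling1 r r ℕ.* r !) ∎
  where
  identity : ∀ r s f → (r ℕ.* 0 ℕ.+ s) ℕ.* (suc r ℕ.* f) ≡ suc r ℕ.* (s ℕ.* f)
  identity = solve-∀

-- The Stirling recurrence [r+1, j+1] = r [r, j+1] + [r, j] with j = r - k - 1, multiplied
-- by (j+1)!; when r ≤ k both sides vanish.
weighted-step : ∀ r k → weighted (suc r) (suc k) ≡ (r ∸ k) ℕ.* weighted r (suc k) ℕ.+ r ℕ.* weighted r k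
weighted-step r k with r ∸ k in r∸k≡
... | zero = sym (trans (cong (r ℕ.*_) (ℕP.*-identityʳ (stirling1 r 0))) (r*[r,0]≡0 r))
  where
  r*[r,0]≡0 : ∀ r → r ℕ.* stirling1 r 0 ≡ 0
  r*[r,0]≡0 zero = refl
  r*[r,0]≡0 (suc r) = ℕP.*-zeroʳ (suc r)
... | suc j rewrite trans (sym (ℕP.pred[m∸n]≡m∸[1+n] r k)) (cong ℕ.pred r∸k≡) =
  identity r (stirling1 r (suc j)) (stirling1 r j) (j !) j
  where
  identity : ∀ r a b f j → (r ℕ.* a ℕ.+ b) ℕ.* (suc j ℕ.* f)
             ≡ suc j ℕ.* (b ℕ.* f) ℕ.+ r ℕ.* (a ℕ.* (suc j ℕ.* f))
  identity = solve-∀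

V : ℕ → ℕ → ℚ
V r m = sgn m * ι (weighted r m)

V-recurrence : StirlingRecurrence V
V-recurrence = record
  { initial = refl
  ; step₀   = λ r → begin
      1ℚ * ι (weighted (suc r) 0)          ≡⟨ cong (λ t → 1ℚ * ι t) (weighted-step₀ r) ⟩
      1ℚ * ι (suc r ℕ.* weighted r 0)      ≡⟨ cong (1ℚ *_) (ι-* (suc r) (weighted r 0)) ⟩
      1ℚ * (ι (suc r) * ι (weighted r 0))  ≡⟨ solve 2 (λ a b → con 1ℚ :* (a :* b) := a :* (con 1ℚ :* b)) refl (ι (suc r)) (ι (weighted r 0)) ⟩
      ι (suc r) * (1ℚ * ι (weighted r 0))  ∎
  ; step    = λ r k _ → begin
      - sgn k * ι (weighted (suc r) (suc k))
        ≡⟨ cong (λ t → - sgn k * ι t) (weighted-step r k) ⟩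
      - sgn k * ι ((r ∸ k) ℕ.* weighted r (suc k) ℕ.+ r ℕ.* weighted r k)
        ≡⟨ cong (- sgn k *_) (trans (ι-+ ((r ∸ k) ℕ.* weighted r (suc k)) (r ℕ.* weighted r k))
                                    (cong₂ _+_ (ι-* (r ∸ k) (weighted r (suc k))) (ι-* r (weighted r k)))) ⟩
      - sgn k * (ι (r ∸ k) * ι (weighted r (suc k)) + ι r * ι (weighted r k))
        ≡⟨ solve 5 (λ s d a i b → (:- s) :* (d :* a :+ i :* b) := d :* ((:- s) :* a) :- i :* (s :* b))
                 refl (sgn k) (ι (r ∸ k)) (ι (weighted r (suc k))) (ι r) (ι (weighted r k)) ⟩
      ι (r ∸ k) * V r (suc k) - ι r * V r k ∎
  }

binomial-factorials : ∀ {n k} → k ≤ n → (n C k) ℕ.* (k ! ℕ.* (n ∸ k) !) ≡ n !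
binomial-factorials {n} {k} k≤n =
  trans (cong (ℕ._* (k ! ℕ.* (n ∸ k) !)) (nCk≡n!/k![n-k]! k≤n))
        (m/n*n≡m {{k ℕP.!* (n ∸ k) !≢0}} (k![n∸k]!∣n! k≤n))

binomial-positive : ∀ {n k} → k ≤ n → 1 ≤ n C k
binomial-positive {n} {k} k≤n = ℕP.n≢0⇒n>0 λ nCk≡0 →
  ℕP.<⇒≢ (ℕP.1≤n! n) (trans (sym (cong (ℕ._* (k ! ℕ.* (n ∸ k) !)) nCk≡0)) (binomial-factorials k≤n))

-- r! times the claimed coefficient is (-1)^m [r, r-m] (r-m)!, because
-- r! = binom(r, r-m) (r-m)! m!.
rhsCoeff-scaled : ∀ {r m} → m ≤ r → rhsCoeff r m * ι (r !) ≡ V r m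
rhsCoeff-scaled {r} {m} m≤r = begin
  rhs * ι (r !)
    ≡⟨ cong (λ t → rhs * ι t) (sym r!≡) ⟩
  rhs * ι (c ℕ.* (k ! ℕ.* m !))
    ≡⟨ cong (rhs *_) (trans (ι-* c (k ! ℕ.* m !)) (cong (ι c *_) (ι-* (k !) (m !)))) ⟩
  rhs * (ι c * (ι (k !) * ι (m !)))
    ≡⟨ solve 4 (λ x a b d → x :* (a :* (b :* d)) := x :* d :* a :* b) refl rhs (ι c) (ι (k !)) (ι (m !)) ⟩
  rhs * ι (m !) * ι c * ι (k !)
    ≡⟨ cong (λ t → t * ι c * ι (k !)) (/ℚ-cancel (P /ℚ ℕ→ℚ c) (ℕP.1≤n! m)) ⟩
  (P /ℚ ℕ→ℚ c) * ι c * ι (k !)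
    ≡⟨ cong (_* ι (k !)) (/ℚ-cancel P (binomial-positive k≤r)) ⟩
  sgn m * ℕ→ℚ S * ι (k !)
    ≡⟨ cong (λ t → sgn m * t * ι (k !)) (ℕ→ℚ≡ι S) ⟩
  sgn m * ι S * ι (k !)
    ≡⟨ trans (ℚP.*-assoc (sgn m) (ι S) (ι (k !))) (cong (sgn m *_) (sym (ι-* S (k !)))) ⟩
  V r m ∎
  where
  k = r ∸ m
  c = r C k
  S = stirling1 r k
  P = sgn m * ℕ→ℚ S
  rhs = rhsCoeff r m
  k≤r : k ≤ r
  k≤r = ℕP.m∸n≤m r m
  r!≡ : c ℕ.* (k ! ℕ.* m !) ≡ r !
  r!≡ = trans (cong (λ t → c ℕ.* (k ! ℕ.* t !)) (sym (ℕP.m∸[m∸n]≡n m≤r))) (binomial-factorials k≤r)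

-- Both r! [z^m] F_r and r! times the claimed coefficient equal (-1)^m [r, r-m] (r-m)!.
lemma7p2 : ∀ (r m : ℕ) → m ≤ r → lhsSeries r m ≡ rhsCoeff r m
lemma7p2 r m m≤r = *-cancelʳ (ι-nonzero (ℕP.1≤n! r)) (begin
  lhsSeries r m * ι (r !)    ≡⟨ cong (_* ι (r !)) (lhsSeries≗F r m) ⟩
  F r m * ι (r !)            ≡⟨ ℚP.*-comm (F r m) (ι (r !)) ⟩
  G r m                      ≡⟨ recurrence-unique G-recurrence V-recurrence r m m≤r ⟩
  V r m                      ≡⟨ sym (rhsCoeff-scaled m≤r) ⟩
  rhsCoeff r m * ι (r !)     ∎)
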